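{- Let $S$ be a set of size $n\ge 3$ and let $G$ be the equivalent metrics graph on the linear orders of $\binom{S}{2}$. The probability that an edge of $G$ chosen uniformly at random is white equals \[ p=\frac{\binom{n-2}{2}}{\binom{n}{2}-1}=1-\frac{4}{n+1}. \]
   Context: Write $xy$ for $\{x,y\}$ and $\binom{S}{2}$ for the set of 2-subsets of $S$. For a linear order $\preccurlyeq$ on $\binom{S}{2}$, $\varphi(\preccurlyeq)$ is the ranking system $(r_x)_{x\in S}$ on $S$ defined by $r_x(y)=|\{z\in S\setminus\{x\}: xz\preccurlyeq xy\}|$ for distinct $x,y$. The equivalent metrics graph $G$ has vertex set the set of all linear orders on $\binom{S}{2}$, with $\preccurlyeq$ and $\preccurlyeq'$ adjacent iff $\preccurlyeq'$ is obtained from $\preccurlyeq$ by swapping two items consecutive in $\preccurlyeq$ (the two 2-sets may intersect); $G$ is $(\binom{n}{2}-1)$-regular. An edge between $\preccurlyeq$ and $\preccurlyeq'$ is white if $\varphi(\preccurlyeq)=\varphi(\preccurlyeq')$ and black otherwise. -}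

module Defs where

open import Data.Bool using (Bool; true; false; if_then_else_; _∧_; not)
open import Data.Nat using (ℕ; zero; suc; _<ᵇ_; _≤ᵇ_)
open import Data.Fin using (Fin; toℕ)
open import Data.Fin.Properties using () renaming (_≟_ to _≟ᶠ_)
open import Data.Product using (_×_; _,_; Σ; ∃; ∃-syntax)
open import Data.Product.Properties using (≡-dec)
open import Data.List using (List; []; _∷_; _++_; length; filterᵇ; allFin)
open import Data.List.Membership.Propositional using (_∈_)
open import Data.List.Relation.Unary.Unique.Propositional using (Unique)
open import Relation.Binary.PropositionalEquality using (_≡_; _≢_)
open import Relation.Nullary.Decidable using (⌊_⌋; Dec)
open import Function.Bundles using (_⇔_)
open import Data.Nat using (_<_)

-- The ground set S is Fin n.  A 2-subset {a,b} of S is represented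
-- canonically by the ordered pair (a , b) with a < b.
Pair : ℕ → Set
Pair n = Fin n × Fin n

IsTwoSet : ∀ {n} → Pair n → Set
IsTwoSet (a , b) = toℕ a < toℕ b

tw : ∀ {n} → Fin n → Fin n → Pair n
tw x z = if toℕ x <ᵇ toℕ z then (x , z) else (z , x)

_≟ₚ_ : ∀ {n} (p q : Pair n) → Dec (p ≡ q)
_≟ₚ_ = ≡-dec _≟ᶠ_ _≟ᶠ_

-- A linear order on binom(S,2) is a list listing every 2-subset exactly
-- once; earlier in the list = smaller.
IsLinOrder : ∀ {n} → List (Pair n) → Set
IsLinOrder {n} o = Unique o × (∀ (p : Pair n) → (p ∈ o) ⇔ IsTwoSet p)

pos : ∀ {n} → List (Pair n) → Pair n → ℕ
pos [] p = zero
pos (q ∷ o) p = if ⌊ p ≟ₚ q ⌋ then zero else suc (pos o p)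

_≼⟨_⟩_ : ∀ {n} → Pair n → List (Pair n) → Pair n → Bool
p ≼⟨ o ⟩ q = pos o p ≤ᵇ pos o q

rank : ∀ {n} → List (Pair n) → Fin n → Fin n → ℕ
rank {n} o x y =
  length (filterᵇ (λ z → not ⌊ z ≟ᶠ x ⌋ ∧ (tw x z ≼⟨ o ⟩ tw x y)) (allFin n))

-- φ(o) = φ(o') : the ranking systems agree (r_x(y) for distinct x, y)
SamePhi : ∀ {n} → List (Pair n) → List (Pair n) → Set
SamePhi {n} o o' = ∀ (x y : Fin n) → x ≢ y → rank o x y ≡ rank o' x y

Adjacent : ∀ {n} → List (Pair n) → List (Pair n) → Set
Adjacent {n} o o' = ∃[ ps ] ∃[ a ] ∃[ b ] ∃[ s ]
  (o ≡ ps ++ a ∷ b ∷ s) × (o' ≡ ps ++ b ∷ a ∷ s)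

-- (ordered) edges of the equivalent metrics graph G
IsEdge : ∀ {n} → List (Pair n) × List (Pair n) → Set
IsEdge (o , o') = IsLinOrder o × IsLinOrder o' × Adjacent o o'

IsWhiteEdge : ∀ {n} → List (Pair n) × List (Pair n) → Set
IsWhiteEdge (o , o') = IsEdge (o , o') × SamePhi o o'

-- An edge of G swaps two consecutive 2-sets a (first) and b. It is white exactly when a and b
-- are disjoint: a comparison xz ≼ xy entering a rank involves two 2-sets through x, so a
-- disjoint swap changes none of them, while for a = xy, b = xz the swap moves z into the count
-- of r_x(y). Now count pairs (e , c) of an edge e and a 2-set c. Those with c disjoint from a
-- number |E| · C(n-2, 2); those with e white and c ≠ a number |W| · (C(n,2) - 1). Exchanging
-- b and c everywhere in e and replacing c by b maps each kind of pair to the other kind (the new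
-- edge swaps a and c), and is an involution, so both counts agree.
module Submission where

open import Level using (Level)
open import Data.Bool using (Bool; true; false; T; not; _∧_)
open import Data.Bool.Properties using (T-≡; T-∧)
open import Data.Empty using (⊥; ⊥-elim)
open import Data.Fin as Fin using (Fin; toℕ)
open import Data.Fin.Properties using () renaming (_≟_ to _≟ᶠ_)
open import Data.List using (List; []; _∷_; _++_; length; map; filter; filterᵇ; cartesianProduct; allFin)
open import Data.List.Properties
  using (length-map; length-++; length-tabulate; map-∘; map-++; map-cong; map-id; map-tabulate;
         filter-++; filter-≐; filter-reject; filter-all; filter-notAll; filter-none)
open import Data.List.Membership.Propositional using (_∈_; _∉_)
open import Data.List.Membership.Propositional.Properties
  using (∈-map⁺; ∈-map⁻; ∈-filter⁺; ∈-filter⁻; ∈-++⁻; ∈-++⁺ˡ; ∈-++⁺ʳ; ∈-allFin; ∈-length;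
         ∈-cartesianProduct⁺; ∈-cartesianProduct⁻)
open import Data.List.Membership.Propositional.Properties.WithK using (unique∧set⇒bag)
open import Data.List.Relation.Binary.BagAndSetEquality using (∼bag⇒↭)
open import Data.List.Relation.Binary.Permutation.Propositional using (_↭_; ↭-refl; ↭-sym; swap; ↭⇒↭ₛ′)
open import Data.List.Relation.Binary.Permutation.Propositional.Properties using (↭-length; ∈-resp-↭)
import Data.List.Relation.Binary.Permutation.Setoid.Properties as Perm
import Data.List.Relation.Unary.Any as Any
open Any using (here; there)
open import Data.List.Relation.Unary.All as All using (_∷_)
import Data.List.Relation.Unary.All.Properties as AllP
open import Data.List.Relation.Unary.Unique.Propositional using (Unique; []; _∷_)
import Data.List.Relation.Unary.Unique.Propositional.Properties as Unique
open import Data.Maybe as Maybe using (Maybe; just; nothing)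
import Data.Maybe.Relation.Unary.Any as MaybeAny
open import Data.Nat using (ℕ; zero; suc; _+_; _*_; _∸_; _≤_; _<_; _>_; _≤ᵇ_; _<ᵇ_; s≤s; z≤n)
open import Data.Nat.Properties
  using (*-comm; *-assoc; *-distribˡ-+; *-cancelˡ-≡; <-irrefl; <-asym; ≤-refl; ≤⇒≤ᵇ; <⇒<ᵇ; <ᵇ⇒<)
open import Data.Nat.Combinatorics using (_C_; nC1≡n; nCk+nC[k+1]≡[n+1]C[k+1])
open import Data.Nat.Tactic.RingSolver using (solve-∀)
open import Data.Product as Product using (_×_; _,_; proj₁; proj₂)
open import Data.Sum using (_⊎_; inj₁; inj₂; [_,_])
open import Data.Unit using (tt)
open import Function using (_∘_; id)
open import Function.Bundles using (_⇔_; mk⇔; Equivalence)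
open import Relation.Binary.Definitions using (DecidableEquality)
open import Relation.Binary.PropositionalEquality
  using (_≡_; _≢_; refl; sym; trans; cong; cong₂; subst; setoid; isEquivalence; module ≡-Reasoning)
open import Relation.Nullary using (Dec; ¬_; yes; no; ¬?; does; _×-dec_)
open import Relation.Nullary.Decidable using (⌊_⌋; T?; fromWitnessFalse)
open import Relation.Unary using (Pred; Decidable; _⊆_)
open import Relation.Unary.Properties using (_∩?_)

open import Defs

private variable
  a b p q : Level
  A : Set a
  B : Set b
  n : ℕ

unique∧involution⇒length-≡ : ∀ (f : A → A) → (∀ x → f (f x) ≡ x) → ∀ {xs ys} →
  Unique xs → Unique ys → (∀ {x} → x ∈ xs → f x ∈ ys) → (∀ {y} → y ∈ ys → f y ∈ xs) →
  length xs ≡ length ys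
unique∧involution⇒length-≡ f f-inv {xs} {ys} xs⁺ ys⁺ xs→ys ys→xs =
  trans (sym (length-map f xs)) (↭-length (∼bag⇒↭ (unique∧set⇒bag fxs⁺ ys⁺ (mk⇔ to from))))
  where
  fxs⁺ : Unique (map f xs)
  fxs⁺ = Unique.map⁺ (λ {x} {y} fx≡fy → trans (sym (f-inv x)) (trans (cong f fx≡fy) (f-inv y))) xs⁺
  to : ∀ {y} → y ∈ map f xs → y ∈ ys
  to y∈ with _ , x∈xs , refl ← ∈-map⁻ f y∈ = xs→ys x∈xs
  from : ∀ {y} → y ∈ ys → y ∈ map f xs
  from {y} y∈ys = subst (_∈ map f xs) (f-inv y) (∈-map⁺ f (ys→xs y∈ys))

module _ {P : Pred B p} (P? : Decidable P) where

  filter-map : ∀ (f : A → B) xs → filter P? (map f xs) ≡ map f (filter (P? ∘ f) xs)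
  filter-map f [] = refl
  filter-map f (x ∷ xs) with does (P? (f x))
  ... | true = cong (f x ∷_) (filter-map f xs)
  ... | false = filter-map f xs

module _ {P : Pred (A × B) p} (P? : Decidable P) where

  length-filter-cartesianProduct : ∀ xs ys k →
    (∀ {x} → x ∈ xs → length (filter (P? ∘ (x ,_)) ys) ≡ k) →
    length (filter P? (cartesianProduct xs ys)) ≡ length xs * k
  length-filter-cartesianProduct [] ys k row = refl
  length-filter-cartesianProduct (x ∷ xs) ys k row = begin
    length (filter P? (map (x ,_) ys ++ cartesianProduct xs ys))
      ≡⟨ cong length (filter-++ P? (map (x ,_) ys) (cartesianProduct xs ys)) ⟩
    length (filter P? (map (x ,_) ys) ++ filter P? (cartesianProduct xs ys))
      ≡⟨ length-++ (filter P? (map (x ,_) ys)) ⟩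
    length (filter P? (map (x ,_) ys)) + length (filter P? (cartesianProduct xs ys))
      ≡⟨ cong₂ _+_ row-x (length-filter-cartesianProduct xs ys k (row ∘ there)) ⟩
    k + length xs * k ∎
    where
    open ≡-Reasoning
    row-x : length (filter P? (map (x ,_) ys)) ≡ k
    row-x = trans (cong length (filter-map P? (x ,_) ys))
                  (trans (length-map (x ,_) (filter (P? ∘ (x ,_)) ys)) (row (here refl)))

module _ {P : Pred A p} {Q : Pred A q} (P? : Decidable P) (Q? : Decidable Q) where

  filter-∩ : ∀ xs → filter (P? ∩? Q?) xs ≡ filter P? (filter Q? xs)
  filter-∩ [] = refl
  filter-∩ (x ∷ xs) with Q? x
  ... | no _ with P? x
  ...   | yes _ = filter-∩ xs
  ...   | no _ = filter-∩ xs
  filter-∩ (x ∷ xs) | yes _ with P? x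
  ...   | yes _ = cong (x ∷_) (filter-∩ xs)
  ...   | no _ = filter-∩ xs

  filter-filter-⊆ : P ⊆ Q → ∀ xs → filter P? (filter Q? xs) ≡ filter P? xs
  filter-filter-⊆ P⊆Q [] = refl
  filter-filter-⊆ P⊆Q (x ∷ xs) with Q? x
  ... | no ¬Qx = trans (filter-filter-⊆ P⊆Q xs) (sym (filter-reject P? (¬Qx ∘ P⊆Q)))
  ... | yes _ with P? x
  ...   | yes _ = cong (x ∷_) (filter-filter-⊆ P⊆Q xs)
  ...   | no _ = filter-filter-⊆ P⊆Q xs

  length-filter-< : P ⊆ Q → ∀ {x xs} → x ∈ xs → ¬ P x → Q x →
    length (filter P? xs) < length (filter Q? xs)
  length-filter-< P⊆Q {x} {xs} x∈xs ¬Px Qx =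
    subst (_< length (filter Q? xs)) (cong length (filter-filter-⊆ P⊆Q xs))
      (filter-notAll P? (filter Q? xs) (Any.map (λ { refl → ¬Px }) (∈-filter⁺ Q? x∈xs Qx)))

filterᵇ-cong : ∀ {f g : A → Bool} → (∀ x → f x ≡ g x) → ∀ xs → filterᵇ f xs ≡ filterᵇ g xs
filterᵇ-cong f≡g = filter-≐ (T? ∘ _) (T? ∘ _) ((λ {x} → subst T (f≡g x)) , (λ {x} → subst T (sym (f≡g x))))

filter-dec-just : ∀ {X : Set a} {P : X → Pred B p} (P? : ∀ x → Decidable (P x)) {m x} → m ≡ just x →
  ∀ ys → filter (λ y → MaybeAny.dec (λ x → P? x y) m) ys ≡ filter (P? x) ys
filter-dec-just P? refl = filter-≐ _ _ (MaybeAny.drop-just , MaybeAny.just)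

module _ (_≟_ : DecidableEquality A) where

  length-filter-≢ : ∀ {x xs} → Unique xs → x ∈ xs → suc (length (filter (λ y → ¬? (y ≟ x)) xs)) ≡ length xs
  length-filter-≢ {xs = y ∷ ys} (y∉ys ∷ _) (here refl) =
    cong (suc ∘ length) (trans (filter-reject (λ z → ¬? (z ≟ y)) (λ y≢y → y≢y refl))
                               (filter-all (λ z → ¬? (z ≟ y)) (All.map (_∘ sym) y∉ys)))
  length-filter-≢ {x} {y ∷ ys} (y∉ys ∷ u) (there x∈ys) with y ≟ x
  ... | yes refl = ⊥-elim (All.lookup y∉ys x∈ys refl)
  ... | no _ = cong suc (length-filter-≢ u x∈ys)

unique-adjacent : ∀ (ps : List A) {a b s} → Unique (ps ++ a ∷ b ∷ s) → a ≢ b × a ∉ ps × b ∉ ps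
unique-adjacent [] ((a≢b ∷ _) ∷ _) = a≢b , (λ ()) , (λ ())
unique-adjacent (r ∷ ps) (r∉ ∷ u) with a≢b , a∉ps , b∉ps ← unique-adjacent ps u =
  a≢b , fresh (here refl) a∉ps , fresh (there (here refl)) b∉ps
  where
  fresh : ∀ {c} → c ∈ _ → c ∉ ps → c ∉ r ∷ ps
  fresh c∈ c∉ps (here refl) = All.lookup r∉ (∈-++⁺ʳ ps c∈) refl
  fresh c∈ c∉ps (there c∈ps) = c∉ps c∈ps

-- Binomial coefficients

C-suc : ∀ k → suc k C 2 ≡ k + k C 2
C-suc k = trans (sym (nCk+nC[k+1]≡[n+1]C[k+1] k 1)) (cong (_+ k C 2) (nC1≡n k))

double-C2 : ∀ k → 2 * (suc k C 2) ≡ suc k * k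
double-C2 zero = refl
double-C2 (suc k) = begin
  2 * (suc (suc k) C 2)        ≡⟨ cong (2 *_) (C-suc (suc k)) ⟩
  2 * (suc k + suc k C 2)      ≡⟨ *-distribˡ-+ 2 (suc k) (suc k C 2) ⟩
  2 * suc k + 2 * (suc k C 2)  ≡⟨ cong (2 * suc k +_) (double-C2 k) ⟩
  2 * suc k + suc k * k        ≡⟨ square k ⟩
  suc (suc k) * suc k          ∎
  where
  open ≡-Reasoning
  square : ∀ k → 2 * suc k + suc k * k ≡ suc (suc k) * suc k
  square = solve-∀

cancel-proportion : ∀ m w e D → 2 * D ≡ suc m * m → w * (suc m + (suc m + D)) ≡ D * e →
  w * (3 + m + 1) ≡ m * e
cancel-proportion m w e D 2D≡ eq = *-cancelˡ-≡ (w * (3 + m + 1)) (m * e) (suc m) (begin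
  suc m * (w * (3 + m + 1))        ≡⟨ expand m w ⟩
  w * (4 * suc m + suc m * m)      ≡⟨ cong (λ t → w * (4 * suc m + t)) 2D≡ ⟨
  w * (4 * suc m + 2 * D)          ≡⟨ regroup m w D ⟩
  2 * (w * (suc m + (suc m + D)))  ≡⟨ cong (2 *_) eq ⟩
  2 * (D * e)                      ≡⟨ *-assoc 2 D e ⟨
  (2 * D) * e                      ≡⟨ cong (_* e) 2D≡ ⟩
  (suc m * m) * e                  ≡⟨ *-assoc (suc m) m e ⟩
  suc m * (m * e)                  ∎)
  where
  open ≡-Reasoning
  expand : ∀ m w → suc m * (w * (3 + m + 1)) ≡ w * (4 * suc m + suc m * m)
  expand = solve-∀
  regroup : ∀ m w D → w * (4 * suc m + 2 * D) ≡ 2 * (w * (suc m + (suc m + D)))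
  regroup = solve-∀

white-proportion : ∀ m w e → w * ((3 + m) C 2 ∸ 1) ≡ (suc m C 2) * e →
  w * (3 + m + 1) + 4 * e ≡ (3 + m + 1) * e
white-proportion m w e eq = begin
  w * (3 + m + 1) + 4 * e  ≡⟨ cong (_+ 4 * e) (cancel-proportion m w e (suc m C 2) (double-C2 m) eq′) ⟩
  m * e + 4 * e            ≡⟨ collect m e ⟩
  (3 + m + 1) * e          ∎
  where
  open ≡-Reasoning
  pred-C : (3 + m) C 2 ∸ 1 ≡ suc m + (suc m + suc m C 2)
  pred-C = cong (_∸ 1) (trans (C-suc (2 + m)) (cong (2 + m +_) (C-suc (suc m))))
  eq′ : w * (suc m + (suc m + suc m C 2)) ≡ (suc m C 2) * e
  eq′ = trans (cong (w *_) (sym pred-C)) eq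
  collect : ∀ m e → m * e + 4 * e ≡ (3 + m + 1) * e
  collect = solve-∀

-- Two-element subsets

pairs : List A → List (A × A)
pairs [] = []
pairs (x ∷ xs) = map (x ,_) xs ++ pairs xs

length-pairs : ∀ (xs : List A) → length (pairs xs) ≡ length xs C 2
length-pairs [] = refl
length-pairs (x ∷ xs) = begin
  length (map (x ,_) xs ++ pairs xs)          ≡⟨ length-++ (map (x ,_) xs) ⟩
  length (map (x ,_) xs) + length (pairs xs)  ≡⟨ cong₂ _+_ (length-map (x ,_) xs) (length-pairs xs) ⟩
  length xs + length xs C 2                   ≡⟨ C-suc (length xs) ⟨
  suc (length xs) C 2                         ∎
  where open ≡-Reasoning

pairs-map : ∀ (f : A → B) xs → pairs (map f xs) ≡ map (Product.map f f) (pairs xs)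
pairs-map f [] = refl
pairs-map f (x ∷ xs) =
  trans (cong₂ _++_ (trans (sym (map-∘ xs)) (map-∘ xs)) (pairs-map f xs))
        (sym (map-++ (Product.map f f) (map (x ,_) xs) (pairs xs)))

∈-pairs⁻ : ∀ {xs : List A} {u v} → (u , v) ∈ pairs xs → u ∈ xs × v ∈ xs
∈-pairs⁻ {xs = x ∷ xs} uv∈ with ∈-++⁻ (map (x ,_) xs) uv∈
... | inj₁ uv∈row with _ , v∈xs , refl ← ∈-map⁻ (x ,_) uv∈row = here refl , there v∈xs
... | inj₂ uv∈rest = Product.map there there (∈-pairs⁻ uv∈rest)

pairs⁺ : ∀ {xs : List A} → Unique xs → Unique (pairs xs)
pairs⁺ [] = []
pairs⁺ {xs = x ∷ xs} (x∉xs ∷ xs⁺) =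
  Unique.++⁺ (Unique.map⁺ (cong proj₂) xs⁺) (pairs⁺ xs⁺) λ (xv∈row , xv∈rest) →
    let _ , _ , eq = ∈-map⁻ (x ,_) xv∈row in
    All.lookup x∉xs (proj₁ (∈-pairs⁻ (subst (_∈ pairs xs) eq xv∈rest))) refl

Both : Pred A p → Pred (A × A) p
Both P uv = P (proj₁ uv) × P (proj₂ uv)

both? : {P : Pred A p} → Decidable P → Decidable (Both P)
both? P? uv = P? (proj₁ uv) ×-dec P? (proj₂ uv)

filter-pairs : {P : Pred A p} (P? : Decidable P) → ∀ xs → filter (both? P?) (pairs xs) ≡ pairs (filter P? xs)
filter-pairs P? [] = refl
filter-pairs P? (x ∷ xs) with P? x
... | yes Px = begin
  filter (both? P?) (map (x ,_) xs ++ pairs xs)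
    ≡⟨ filter-++ (both? P?) (map (x ,_) xs) (pairs xs) ⟩
  filter (both? P?) (map (x ,_) xs) ++ filter (both? P?) (pairs xs)
    ≡⟨ cong₂ _++_ (filter-map (both? P?) (x ,_) xs) (filter-pairs P? xs) ⟩
  map (x ,_) (filter (both? P? ∘ (x ,_)) xs) ++ pairs (filter P? xs)
    ≡⟨ cong (λ ys → map (x ,_) ys ++ pairs (filter P? xs)) (filter-≐ (both? P? ∘ (x ,_)) P? (proj₂ , (Px ,_)) xs) ⟩
  map (x ,_) (filter P? xs) ++ pairs (filter P? xs) ∎
  where open ≡-Reasoning
... | no ¬Px = begin
  filter (both? P?) (map (x ,_) xs ++ pairs xs)
    ≡⟨ filter-++ (both? P?) (map (x ,_) xs) (pairs xs) ⟩
  filter (both? P?) (map (x ,_) xs) ++ filter (both? P?) (pairs xs)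
    ≡⟨ cong₂ _++_ (filter-none (both? P?) (AllP.map⁺ (All.universal (λ _ → ¬Px ∘ proj₁) xs))) (filter-pairs P? xs) ⟩
  pairs (filter P? xs) ∎
  where open ≡-Reasoning

twoSets : ∀ n → List (Pair n)
twoSets n = pairs (allFin n)

length-twoSets : ∀ n → length (twoSets n) ≡ n C 2
length-twoSets n = trans (length-pairs (allFin n)) (cong (_C 2) (length-tabulate {n = n} id))

twoSets⁺ : ∀ n → Unique (twoSets n)
twoSets⁺ n = pairs⁺ (Unique.allFin⁺ n)

twoSets-suc : ∀ n → twoSets (suc n) ≡
  map (λ j → Fin.zero , Fin.suc j) (allFin n) ++ map (Product.map Fin.suc Fin.suc) (twoSets n)
twoSets-suc n = begin
  pairs (allFin (suc n))
    ≡⟨ cong (λ xs → pairs (Fin.zero ∷ xs)) (sym (map-tabulate id Fin.suc)) ⟩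
  pairs (Fin.zero ∷ map Fin.suc (allFin n))
    ≡⟨ cong (map (Fin.zero ,_) (map Fin.suc (allFin n)) ++_) (pairs-map Fin.suc (allFin n)) ⟩
  map (Fin.zero ,_) (map Fin.suc (allFin n)) ++ map (Product.map Fin.suc Fin.suc) (twoSets n)
    ≡⟨ cong (_++ map (Product.map Fin.suc Fin.suc) (twoSets n)) (sym (map-∘ (allFin n))) ⟩
  map (λ j → Fin.zero , Fin.suc j) (allFin n) ++ map (Product.map Fin.suc Fin.suc) (twoSets n) ∎
  where open ≡-Reasoning

∈-twoSets⁻ : ∀ {p : Pair n} → p ∈ twoSets n → IsTwoSet p
∈-twoSets⁻ {suc n} p∈ with ∈-++⁻ (map (λ j → Fin.zero , Fin.suc j) (allFin n)) (subst (_ ∈_) (twoSets-suc n) p∈)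
... | inj₁ p∈row with _ , _ , refl ← ∈-map⁻ (λ j → Fin.zero , Fin.suc j) p∈row = s≤s z≤n
... | inj₂ p∈rest with _ , q∈ , refl ← ∈-map⁻ (Product.map Fin.suc Fin.suc) p∈rest = s≤s (∈-twoSets⁻ q∈)

∈-twoSets⁺ : ∀ {p : Pair n} → IsTwoSet p → p ∈ twoSets n
∈-twoSets⁺ {suc n} {p} p⁺ = subst (p ∈_) (sym (twoSets-suc n)) (row-or-rest p p⁺)
  where
  row-or-rest : ∀ (p : Pair (suc n)) → IsTwoSet p →
    p ∈ map (λ j → Fin.zero , Fin.suc j) (allFin n) ++ map (Product.map Fin.suc Fin.suc) (twoSets n)
  row-or-rest (Fin.zero , Fin.suc j) _ = ∈-++⁺ˡ (∈-map⁺ (λ j → Fin.zero , Fin.suc j) (∈-allFin j))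
  row-or-rest (Fin.suc i , Fin.suc j) (s≤s i<j) =
    ∈-++⁺ʳ _ (∈-map⁺ (Product.map Fin.suc Fin.suc) (∈-twoSets⁺ i<j))

twoSets-linOrder : ∀ n → IsLinOrder (twoSets n)
twoSets-linOrder n = twoSets⁺ n , λ p → mk⇔ ∈-twoSets⁻ ∈-twoSets⁺

twoSet-≢ : ∀ {u v : Fin n} → IsTwoSet (u , v) → u ≢ v
twoSet-≢ u<v u≡v = <-irrefl (cong toℕ u≡v) u<v

_∈ₚ_ : Fin n → Pair n → Set
x ∈ₚ p = x ≡ proj₁ p ⊎ x ≡ proj₂ p

_∉ₚ_ : Fin n → Pair n → Set
x ∉ₚ p = x ≢ proj₁ p × x ≢ proj₂ p

_∉ₚ?_ : (x : Fin n) (p : Pair n) → Dec (x ∉ₚ p)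
x ∉ₚ? p = ¬? (x ≟ᶠ proj₁ p) ×-dec ¬? (x ≟ᶠ proj₂ p)

Disjoint : Pair n → Pair n → Set
Disjoint p = Both (_∉ₚ p)

disjoint? : (p q : Pair n) → Dec (Disjoint p q)
disjoint? p = both? (_∉ₚ? p)

disjoint-∈ₚ : ∀ {p q : Pair n} {x} → Disjoint p q → x ∈ₚ p → x ∈ₚ q → ⊥
disjoint-∈ₚ ((q₁≢p₁ , q₁≢p₂) , _) x∈p (inj₁ refl) = [ q₁≢p₁ , q₁≢p₂ ] x∈p
disjoint-∈ₚ (_ , (q₂≢p₁ , q₂≢p₂)) x∈p (inj₂ refl) = [ q₂≢p₁ , q₂≢p₂ ] x∈p

disjoint⇒≢ : ∀ {p q : Pair n} → Disjoint p q → p ≢ q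
disjoint⇒≢ ((p₁≢p₁ , _) , _) refl = p₁≢p₁ refl

length-filter-∉ₚ : ∀ {p : Pair n} → IsTwoSet p → length (filter (_∉ₚ? p) (allFin n)) ≡ n ∸ 2
length-filter-∉ₚ {n} {x , y} x<y = begin
  length (filter (_∉ₚ? (x , y)) (allFin n))     ≡⟨ cong length (filter-∩ (≢? x) (≢? y) (allFin n)) ⟩
  length (filter (≢? x) (filter (≢? y) (allFin n))) ≡⟨ cong (_∸ 2) (trans (cong suc drop-x) drop-y) ⟩
  n ∸ 2                                         ∎
  where
  open ≡-Reasoning
  ≢? : ∀ u v → Dec (v ≢ u)
  ≢? u v = ¬? (v ≟ᶠ u)
  drop-x : suc (length (filter (≢? x) (filter (≢? y) (allFin n)))) ≡ length (filter (≢? y) (allFin n))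
  drop-x = length-filter-≢ _≟ᶠ_ (Unique.filter⁺ (≢? y) (Unique.allFin⁺ n))
             (∈-filter⁺ (≢? y) (∈-allFin x) (twoSet-≢ x<y))
  drop-y : suc (length (filter (≢? y) (allFin n))) ≡ n
  drop-y = trans (length-filter-≢ _≟ᶠ_ (Unique.allFin⁺ n) (∈-allFin y)) (length-tabulate {n = n} id)

length-filter-disjoint : ∀ {p : Pair n} → IsTwoSet p → length (filter (disjoint? p) (twoSets n)) ≡ (n ∸ 2) C 2
length-filter-disjoint {n} {p} p⁺ = begin
  length (filter (disjoint? p) (pairs (allFin n))) ≡⟨ cong length (filter-pairs (_∉ₚ? p) (allFin n)) ⟩
  length (pairs (filter (_∉ₚ? p) (allFin n)))      ≡⟨ length-pairs (filter (_∉ₚ? p) (allFin n)) ⟩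
  length (filter (_∉ₚ? p) (allFin n)) C 2          ≡⟨ cong (_C 2) (length-filter-∉ₚ p⁺) ⟩
  (n ∸ 2) C 2                                      ∎
  where open ≡-Reasoning

length-filter-≢-twoSets : ∀ {p : Pair n} → IsTwoSet p →
  length (filter (λ q → ¬? (q ≟ₚ p)) (twoSets n)) ≡ n C 2 ∸ 1
length-filter-≢-twoSets {n} p⁺ =
  cong (_∸ 1) (trans (length-filter-≢ _≟ₚ_ (twoSets⁺ n) (∈-twoSets⁺ p⁺)) (length-twoSets n))

∈ₚ-tw : ∀ (x z : Fin n) → x ∈ₚ tw x z
∈ₚ-tw x z with toℕ x <ᵇ toℕ z
... | true = inj₁ refl
... | false = inj₂ refl

tw-< : ∀ {u v : Fin n} → IsTwoSet (u , v) → tw u v ≡ (u , v)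
tw-< {u = u} {v} u<v with toℕ u <ᵇ toℕ v in eq
... | true = refl
... | false = ⊥-elim (subst T eq (<⇒<ᵇ u<v))

tw-> : ∀ {u v : Fin n} → IsTwoSet (u , v) → tw v u ≡ (u , v)
tw-> {u = u} {v} u<v with toℕ v <ᵇ toℕ u in eq
... | true = ⊥-elim (<-asym u<v (<ᵇ⇒< (toℕ v) (toℕ u) (subst T (sym eq) tt)))
... | false = refl

-- Comparisons across an adjacent swap

≤ᵇ-suc : ∀ x y → (suc x ≤ᵇ suc y) ≡ (x ≤ᵇ y)
≤ᵇ-suc zero y = refl
≤ᵇ-suc (suc x) y = refl

≼-refl : ∀ (o : List (Pair n)) p → (p ≼⟨ o ⟩ p) ≡ true
≼-refl o p = Equivalence.to T-≡ (≤⇒≤ᵇ (≤-refl {pos o p}))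

≼-drop-prefix : ∀ {ps : List (Pair n)} {p q} l → p ∉ ps → q ∉ ps → (p ≼⟨ ps ++ l ⟩ q) ≡ (p ≼⟨ l ⟩ q)
≼-drop-prefix {ps = []} l _ _ = refl
≼-drop-prefix {ps = r ∷ ps} {p} {q} l p∉ q∉ with p ≟ₚ r | q ≟ₚ r
... | yes p≡r | _ = ⊥-elim (p∉ (here p≡r))
... | no _ | yes q≡r = ⊥-elim (q∉ (here q≡r))
... | no _ | no _ =
  trans (≤ᵇ-suc (pos (ps ++ l) p) (pos (ps ++ l) q)) (≼-drop-prefix l (p∉ ∘ there) (q∉ ∘ there))

≼-swap-other-head : ∀ {a b : Pair n} s p q → a ≢ b → ¬ (p ≡ a × q ≡ b) → ¬ (p ≡ b × q ≡ a) →
  (p ≼⟨ a ∷ b ∷ s ⟩ q) ≡ (p ≼⟨ b ∷ a ∷ s ⟩ q)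
≼-swap-other-head {a = a} {b} s p q a≢b ¬ab ¬ba with p ≟ₚ a | p ≟ₚ b | q ≟ₚ a | q ≟ₚ b
... | yes refl | yes refl | _ | _ = ⊥-elim (a≢b refl)
... | _ | _ | yes refl | yes refl = ⊥-elim (a≢b refl)
... | yes refl | no _ | _ | yes refl = ⊥-elim (¬ab (refl , refl))
... | no _ | yes refl | yes refl | _ = ⊥-elim (¬ba (refl , refl))
... | yes _ | no _ | yes _ | no _ = refl
... | yes _ | no _ | no _ | no _ = refl
... | no _ | yes _ | no _ | yes _ = refl
... | no _ | yes _ | no _ | no _ = refl
... | no _ | no _ | yes _ | no _ = refl
... | no _ | no _ | no _ | yes _ = refl
... | no _ | no _ | no _ | no _ = refl

≼-swap-other : ∀ (ps : List (Pair n)) {a b} s p q → a ≢ b → ¬ (p ≡ a × q ≡ b) → ¬ (p ≡ b × q ≡ a) →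
  (p ≼⟨ ps ++ a ∷ b ∷ s ⟩ q) ≡ (p ≼⟨ ps ++ b ∷ a ∷ s ⟩ q)
≼-swap-other [] s p q = ≼-swap-other-head s p q
≼-swap-other (r ∷ ps) {a} {b} s p q a≢b ¬ab ¬ba with p ≟ₚ r | q ≟ₚ r
... | yes _ | _ = refl
... | no _ | yes _ = refl
... | no _ | no _ = begin
  suc (pos o p) ≤ᵇ suc (pos o q)   ≡⟨ ≤ᵇ-suc (pos o p) (pos o q) ⟩
  (p ≼⟨ o ⟩ q)                     ≡⟨ ≼-swap-other ps s p q a≢b ¬ab ¬ba ⟩
  (p ≼⟨ o′ ⟩ q)                    ≡⟨ ≤ᵇ-suc (pos o′ p) (pos o′ q) ⟨
  suc (pos o′ p) ≤ᵇ suc (pos o′ q) ∎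
  where
  open ≡-Reasoning
  o = ps ++ a ∷ b ∷ s
  o′ = ps ++ b ∷ a ∷ s

≼-swap-later : ∀ (ps : List (Pair n)) {a b} s → a ∉ ps → b ∉ ps → a ≢ b → (b ≼⟨ ps ++ a ∷ b ∷ s ⟩ a) ≡ false
≼-swap-later ps {a} {b} s a∉ b∉ a≢b = trans (≼-drop-prefix (a ∷ b ∷ s) b∉ a∉) head
  where
  head : (b ≼⟨ a ∷ b ∷ s ⟩ a) ≡ false
  head with b ≟ₚ a | b ≟ₚ b | a ≟ₚ a
  ... | yes b≡a | _ | _ = ⊥-elim (a≢b (sym b≡a))
  ... | no _ | yes _ | yes _ = refl
  ... | no _ | no b≢b | _ = ⊥-elim (b≢b refl)
  ... | no _ | _ | no a≢a = ⊥-elim (a≢a refl)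

≼-swap-earlier : ∀ (ps : List (Pair n)) {a b} s → a ∉ ps → b ∉ ps → (b ≼⟨ ps ++ b ∷ a ∷ s ⟩ a) ≡ true
≼-swap-earlier ps {a} {b} s a∉ b∉ = trans (≼-drop-prefix (b ∷ a ∷ s) b∉ a∉) head
  where
  head : (b ≼⟨ b ∷ a ∷ s ⟩ a) ≡ true
  head with b ≟ₚ b
  ... | yes _ = refl
  ... | no b≢b = ⊥-elim (b≢b refl)

≼-swap-mono : ∀ (ps : List (Pair n)) {a b} s p → a ∉ ps → b ∉ ps → a ≢ b →
  T (p ≼⟨ ps ++ a ∷ b ∷ s ⟩ a) → T (p ≼⟨ ps ++ b ∷ a ∷ s ⟩ a)
≼-swap-mono ps {a} {b} s p a∉ b∉ a≢b p≼a with p ≟ₚ a | p ≟ₚ b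
... | yes refl | _ = subst T (sym (≼-refl (ps ++ b ∷ p ∷ s) p)) tt
... | no _ | yes refl = ⊥-elim (subst T (≼-swap-later ps s a∉ b∉ a≢b) p≼a)
... | no p≢a | no p≢b = subst T (≼-swap-other ps s p a a≢b (a≢b ∘ proj₂) (p≢b ∘ proj₁)) p≼a

-- White edges are the swaps of disjoint 2-sets

samePhi-swap-disjoint : ∀ (ps : List (Pair n)) {a b} s → a ≢ b → Disjoint a b →
  SamePhi (ps ++ a ∷ b ∷ s) (ps ++ b ∷ a ∷ s)
samePhi-swap-disjoint {n} ps {a} {b} s a≢b ab x y _ = cong length (filterᵇ-cong same (allFin n))
  where
  same : ∀ z → (not ⌊ z ≟ᶠ x ⌋ ∧ (tw x z ≼⟨ ps ++ a ∷ b ∷ s ⟩ tw x y))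
             ≡ (not ⌊ z ≟ᶠ x ⌋ ∧ (tw x z ≼⟨ ps ++ b ∷ a ∷ s ⟩ tw x y))
  same z = cong (not ⌊ z ≟ᶠ x ⌋ ∧_) (≼-swap-other ps s (tw x z) (tw x y) a≢b
    (λ (xz≡a , xy≡b) → disjoint-∈ₚ ab (subst (x ∈ₚ_) xz≡a (∈ₚ-tw x z)) (subst (x ∈ₚ_) xy≡b (∈ₚ-tw x y)))
    (λ (xz≡b , xy≡a) → disjoint-∈ₚ ab (subst (x ∈ₚ_) xy≡a (∈ₚ-tw x y)) (subst (x ∈ₚ_) xz≡b (∈ₚ-tw x z))))

rank-swap-shared : ∀ (ps : List (Pair n)) s {x y z} → z ≢ x →
  tw x y ≢ tw x z → tw x y ∉ ps → tw x z ∉ ps →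
  rank (ps ++ tw x y ∷ tw x z ∷ s) x y < rank (ps ++ tw x z ∷ tw x y ∷ s) x y
rank-swap-shared {n} ps s {x} {y} {z} z≢x a≢b a∉ b∉ =
  length-filter-< (T? ∘ counted o) (T? ∘ counted o′) mono (∈-allFin z) z-after z-before
  where
  o = ps ++ tw x y ∷ tw x z ∷ s
  o′ = ps ++ tw x z ∷ tw x y ∷ s
  counted : List (Pair n) → Fin n → Bool
  counted l z′ = not ⌊ z′ ≟ᶠ x ⌋ ∧ (tw x z′ ≼⟨ l ⟩ tw x y)
  mono : ∀ {z′} → T (counted o z′) → T (counted o′ z′)
  mono {z′} t with z′≢x , z′≼ ← Equivalence.to T-∧ t =
    Equivalence.from T-∧ (z′≢x , ≼-swap-mono ps s (tw x z′) a∉ b∉ a≢b z′≼)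
  z-after : ¬ T (counted o z)
  z-after t = subst T (≼-swap-later ps s a∉ b∉ a≢b) (proj₂ (Equivalence.to T-∧ t))
  z-before : T (counted o′ z)
  z-before = Equivalence.from T-∧ (fromWitnessFalse z≢x , subst T (sym (≼-swap-earlier ps s a∉ b∉)) tt)

shared-vertex⇒¬samePhi : ∀ (ps : List (Pair n)) {a b} s {x y z} → tw x y ≡ a → tw x z ≡ b → x ≢ y → z ≢ x →
  Unique (ps ++ a ∷ b ∷ s) → ¬ SamePhi (ps ++ a ∷ b ∷ s) (ps ++ b ∷ a ∷ s)
shared-vertex⇒¬samePhi ps s {x} {y} refl refl x≢y z≢x u same
  with a≢b , a∉ , b∉ ← unique-adjacent ps u =
  <-irrefl (same x y x≢y) (rank-swap-shared ps s z≢x a≢b a∉ b∉)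

samePhi-swap⇒disjoint : ∀ (ps : List (Pair n)) {a b} s → IsTwoSet a → IsTwoSet b → Unique (ps ++ a ∷ b ∷ s) →
  SamePhi (ps ++ a ∷ b ∷ s) (ps ++ b ∷ a ∷ s) → Disjoint a b
samePhi-swap⇒disjoint ps {a₁ , a₂} {b₁ , b₂} s a⁺ b⁺ u same
  with b₁ ≟ᶠ a₁ | b₁ ≟ᶠ a₂ | b₂ ≟ᶠ a₁ | b₂ ≟ᶠ a₂
... | yes refl | _ | _ | _ =
  ⊥-elim (shared-vertex⇒¬samePhi ps s (tw-< a⁺) (tw-< b⁺) (twoSet-≢ a⁺) (twoSet-≢ b⁺ ∘ sym) u same)
... | _ | yes refl | _ | _ =
  ⊥-elim (shared-vertex⇒¬samePhi ps s (tw-> a⁺) (tw-< b⁺) (twoSet-≢ a⁺ ∘ sym) (twoSet-≢ b⁺ ∘ sym) u same)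
... | _ | _ | yes refl | _ =
  ⊥-elim (shared-vertex⇒¬samePhi ps s (tw-< a⁺) (tw-> b⁺) (twoSet-≢ a⁺) (twoSet-≢ b⁺) u same)
... | _ | _ | _ | yes refl =
  ⊥-elim (shared-vertex⇒¬samePhi ps s (tw-> a⁺) (tw-> b⁺) (twoSet-≢ a⁺ ∘ sym) (twoSet-≢ b⁺) u same)
... | no b₁≢a₁ | no b₁≢a₂ | no b₂≢a₁ | no b₂≢a₂ = (b₁≢a₁ , b₁≢a₂) , (b₂≢a₁ , b₂≢a₂)

module Transposition {A : Set a} (_≟_ : DecidableEquality A) where

  transpose : A → A → A → A
  transpose b c p with p ≟ b | p ≟ c
  ... | yes _ | _ = c
  ... | no _ | yes _ = b
  ... | no _ | no _ = p

  transpose-left : ∀ b c → transpose b c b ≡ c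
  transpose-left b c with b ≟ b
  ... | yes _ = refl
  ... | no b≢b = ⊥-elim (b≢b refl)

  transpose-right : ∀ b c → transpose b c c ≡ b
  transpose-right b c with c ≟ b | c ≟ c
  ... | yes refl | _ = refl
  ... | no _ | yes _ = refl
  ... | no _ | no c≢c = ⊥-elim (c≢c refl)

  transpose-fixes : ∀ {b c p} → p ≢ b → p ≢ c → transpose b c p ≡ p
  transpose-fixes {b} {c} {p} p≢b p≢c with p ≟ b | p ≟ c
  ... | yes p≡b | _ = ⊥-elim (p≢b p≡b)
  ... | no _ | yes p≡c = ⊥-elim (p≢c p≡c)
  ... | no _ | no _ = refl

  transpose-involutive : ∀ b c p → transpose c b (transpose b c p) ≡ p
  transpose-involutive b c p with p ≟ b | p ≟ c
  ... | yes refl | _ = transpose-left c p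
  ... | no _ | yes refl = transpose-right p b
  ... | no p≢b | no p≢c = transpose-fixes p≢c p≢b

  transpose-injective : ∀ b c {p q} → transpose b c p ≡ transpose b c q → p ≡ q
  transpose-injective b c {p} {q} eq =
    trans (sym (transpose-involutive b c p)) (trans (cong (transpose c b) eq) (transpose-involutive b c q))

  adjacent : List A → A → A → List A → List A × List A
  adjacent ps a b s = ps ++ a ∷ b ∷ s , ps ++ b ∷ a ∷ s

  relabel : (A → A) → List A × List A → List A × List A
  relabel f = Product.map (map f) (map f)

  relabel-adjacent : ∀ ps {a b} s c → a ≢ b → a ≢ c →
    relabel (transpose b c) (adjacent ps a b s) ≡ adjacent (map (transpose b c) ps) a c (map (transpose b c) s)
  relabel-adjacent ps {a} {b} s c a≢b a≢c =
    cong₂ _,_ (trans (map-++ σ ps (a ∷ b ∷ s)) (cong₂ (λ u v → map σ ps ++ u ∷ v ∷ map σ s) σa σb))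
              (trans (map-++ σ ps (b ∷ a ∷ s)) (cong₂ (λ u v → map σ ps ++ v ∷ u ∷ map σ s) σa σb))
    where
    σ = transpose b c
    σa = transpose-fixes a≢b a≢c
    σb = transpose-left b c

  relabel-involutive : ∀ b c e → relabel (transpose c b) (relabel (transpose b c) e) ≡ e
  relabel-involutive b c (o , o′) = cong₂ _,_ (back o) (back o′)
    where
    back : ∀ l → map (transpose c b) (map (transpose b c) l) ≡ l
    back l = trans (sym (map-∘ l)) (trans (map-cong (transpose-involutive b c) l) (map-id l))

  firstDifference : List A → List A → Maybe (A × A)
  firstDifference (x ∷ xs) (y ∷ ys) with x ≟ y
  ... | yes _ = firstDifference xs ys
  ... | no _ = just (x , y)
  firstDifference _ _ = nothing

  firstDifference-map : ∀ {f} → (∀ {x y} → f x ≡ f y → x ≡ y) → ∀ xs ys →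
    firstDifference (map f xs) (map f ys) ≡ Maybe.map (Product.map f f) (firstDifference xs ys)
  firstDifference-map f-inj [] _ = refl
  firstDifference-map f-inj (_ ∷ _) [] = refl
  firstDifference-map {f} f-inj (x ∷ xs) (y ∷ ys) with x ≟ y | f x ≟ f y
  ... | yes refl | yes _ = firstDifference-map f-inj xs ys
  ... | yes refl | no fx≢fx = ⊥-elim (fx≢fx refl)
  ... | no x≢y | yes fx≡fy = ⊥-elim (x≢y (f-inj fx≡fy))
  ... | no _ | no _ = refl

  swapped : List A × List A → Maybe (A × A)
  swapped (o , o′) = firstDifference o o′

  swapped-adjacent : ∀ ps {a b} s → a ≢ b → swapped (adjacent ps a b s) ≡ just (a , b)
  swapped-adjacent [] {a} {b} s a≢b with a ≟ b
  ... | yes a≡b = ⊥-elim (a≢b a≡b)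
  ... | no _ = refl
  swapped-adjacent (r ∷ ps) s a≢b with r ≟ r
  ... | yes _ = swapped-adjacent ps s a≢b
  ... | no r≢r = ⊥-elim (r≢r refl)

  first-adjacent : ∀ {P : Pred (A × A) p} ps {a b} s → a ≢ b →
    MaybeAny.Any P (swapped (adjacent ps a b s)) ⇔ P (a , b)
  first-adjacent ps s a≢b rewrite swapped-adjacent ps s a≢b = mk⇔ MaybeAny.drop-just MaybeAny.just

  flipAt : Maybe (A × A) → (List A × List A) × A → (List A × List A) × A
  flipAt (just (_ , b)) (e , c) = relabel (transpose b c) e , b
  flipAt nothing ec = ec

  flipSwap : (List A × List A) × A → (List A × List A) × A
  flipSwap (e , c) = flipAt (swapped e) (e , c)

  flipSwap-swapped : ∀ {e c m} → swapped e ≡ m → flipSwap (e , c) ≡ flipAt m (e , c)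
  flipSwap-swapped {e} {c} = cong (λ m → flipAt m (e , c))

  flipSwap-adjacent : ∀ ps {a b} s c → a ≢ b → a ≢ c →
    flipSwap (adjacent ps a b s , c) ≡ (adjacent (map (transpose b c) ps) a c (map (transpose b c) s) , b)
  flipSwap-adjacent ps s c a≢b a≢c =
    trans (flipSwap-swapped (swapped-adjacent ps s a≢b)) (cong (_, _) (relabel-adjacent ps s c a≢b a≢c))

  flipSwap-involutive : ∀ ec → flipSwap (flipSwap ec) ≡ ec
  flipSwap-involutive (e , c) with swapped e in eq
  ... | nothing = flipSwap-swapped eq
  ... | just (a , b) = begin
    flipSwap (relabel (transpose b c) e , b)                 ≡⟨ flipSwap-swapped swapped-flip ⟩
    relabel (transpose c b) (relabel (transpose b c) e) , c  ≡⟨ cong (_, c) (relabel-involutive b c e) ⟩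
    e , c                                                    ∎
    where
    open ≡-Reasoning
    swapped-flip : swapped (relabel (transpose b c) e) ≡ just (transpose b c a , c)
    swapped-flip = begin
      swapped (relabel (transpose b c) e)
        ≡⟨ firstDifference-map (transpose-injective b c) (proj₁ e) (proj₂ e) ⟩
      Maybe.map (Product.map (transpose b c) (transpose b c)) (swapped e)
        ≡⟨ cong (Maybe.map (Product.map (transpose b c) (transpose b c))) eq ⟩
      just (transpose b c a , transpose b c b)
        ≡⟨ cong (λ v → just (transpose b c a , v)) (transpose-left b c) ⟩
      just (transpose b c a , c) ∎

module PairTransposition {n : ℕ} = Transposition (_≟ₚ_ {n})
open PairTransposition

Edge : ℕ → Set
Edge n = List (Pair n) × List (Pair n)

linOrder-resp-↭ : ∀ {o o′ : List (Pair n)} → o ↭ o′ → IsLinOrder o → IsLinOrder o′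
linOrder-resp-↭ {n} o↭o′ (u , mem) =
  Perm.Unique-resp-↭ (setoid (Pair n)) (↭⇒↭ₛ′ isEquivalence o↭o′) u ,
  λ p → mk⇔ (Equivalence.to (mem p) ∘ ∈-resp-↭ (↭-sym o↭o′)) (∈-resp-↭ o↭o′ ∘ Equivalence.from (mem p))

edge-at-head : ∀ {a b : Pair n} {s} → IsLinOrder (a ∷ b ∷ s) → IsEdge (adjacent [] a b s)
edge-at-head lo = lo , linOrder-resp-↭ (swap _ _ ↭-refl) lo , [] , _ , _ , _ , refl , refl

transpose-twoSet : ∀ {b c p : Pair n} → IsTwoSet b → IsTwoSet c → IsTwoSet p → IsTwoSet (transpose b c p)
transpose-twoSet {b = b} {c} {p} b⁺ c⁺ p⁺ with p ≟ₚ b | p ≟ₚ c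
... | yes _ | _ = c⁺
... | no _ | yes _ = b⁺
... | no _ | no _ = p⁺

linOrder-transpose : ∀ {b c : Pair n} {o} → IsTwoSet b → IsTwoSet c → IsLinOrder o →
  IsLinOrder (map (transpose b c) o)
linOrder-transpose {b = b} {c} {o} b⁺ c⁺ (u , mem) =
  Unique.map⁺ (transpose-injective b c) u , λ p → mk⇔ to (from p)
  where
  to : ∀ {p} → p ∈ map (transpose b c) o → IsTwoSet p
  to p∈ with q , q∈ , refl ← ∈-map⁻ (transpose b c) p∈ = transpose-twoSet b⁺ c⁺ (Equivalence.to (mem q) q∈)
  from : ∀ p → IsTwoSet p → p ∈ map (transpose b c) o
  from p p⁺ = subst (_∈ map (transpose b c) o) (transpose-involutive c b p)
    (∈-map⁺ (transpose b c) (Equivalence.from (mem _) (transpose-twoSet c⁺ b⁺ p⁺)))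

adjacent-twoSets : ∀ {ps : List (Pair n)} {a b s} → IsLinOrder (ps ++ a ∷ b ∷ s) → IsTwoSet a × IsTwoSet b
adjacent-twoSets {ps = ps} {a} {b} (_ , mem) =
  Equivalence.to (mem a) (∈-++⁺ʳ ps (here refl)) , Equivalence.to (mem b) (∈-++⁺ʳ ps (there (here refl)))

edge-transpose : ∀ ps {a b : Pair n} s {c} → IsEdge (adjacent ps a b s) → IsTwoSet c → a ≢ b → a ≢ c →
  IsEdge (adjacent (map (transpose b c) ps) a c (map (transpose b c) s))
edge-transpose ps {a} {b} s {c} (lo , lo′ , _) c⁺ a≢b a≢c =
  subst IsLinOrder (cong proj₁ relabeled) (linOrder-transpose b⁺ c⁺ lo) ,
  subst IsLinOrder (cong proj₂ relabeled) (linOrder-transpose b⁺ c⁺ lo′) ,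
  _ , _ , _ , _ , refl , refl
  where
  b⁺ = proj₂ (adjacent-twoSets lo)
  relabeled = relabel-adjacent ps s c a≢b a≢c

-- The double counting

DisjointFromFirst : Edge n × Pair n → Set
DisjointFromFirst (e , c) = MaybeAny.Any (λ ab → Disjoint (proj₁ ab) c) (swapped e)

disjointFromFirst? : Decidable (DisjointFromFirst {n})
disjointFromFirst? (e , c) = MaybeAny.dec (λ ab → disjoint? (proj₁ ab) c) (swapped e)

OtherThanFirst : Edge n × Pair n → Set
OtherThanFirst (e , d) = MaybeAny.Any (λ ab → d ≢ proj₁ ab) (swapped e)

otherThanFirst? : Decidable (OtherThanFirst {n})
otherThanFirst? (e , d) = MaybeAny.dec (λ ab → ¬? (d ≟ₚ proj₁ ab)) (swapped e)

module DoubleCounting {n} (E W : List (Edge n))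
  (E⁺ : Unique E) (E⇔ : ∀ e → e ∈ E ⇔ IsEdge e) (W⁺ : Unique W) (W⇔ : ∀ e → e ∈ W ⇔ IsWhiteEdge e) where

  U V : List (Edge n × Pair n)
  U = filter disjointFromFirst? (cartesianProduct E (twoSets n))
  V = filter otherThanFirst? (cartesianProduct W (twoSets n))

  length-U : length U ≡ length E * ((n ∸ 2) C 2)
  length-U = length-filter-cartesianProduct disjointFromFirst? E (twoSets n) _ row
    where
    row : ∀ {e} → e ∈ E → length (filter (disjointFromFirst? ∘ (e ,_)) (twoSets n)) ≡ (n ∸ 2) C 2
    row e∈E with lo , _ , ps , a , b , s , refl , refl ← Equivalence.to (E⇔ _) e∈E =
      trans (cong length (filter-dec-just (λ ab → disjoint? (proj₁ ab))
                            (swapped-adjacent ps s (proj₁ (unique-adjacent ps (proj₁ lo)))) (twoSets n)))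
            (length-filter-disjoint (proj₁ (adjacent-twoSets lo)))

  length-V : length V ≡ length W * (n C 2 ∸ 1)
  length-V = length-filter-cartesianProduct otherThanFirst? W (twoSets n) _ row
    where
    row : ∀ {e} → e ∈ W → length (filter (otherThanFirst? ∘ (e ,_)) (twoSets n)) ≡ n C 2 ∸ 1
    row e∈W with (lo , _ , ps , a , b , s , refl , refl) , _ ← Equivalence.to (W⇔ _) e∈W =
      trans (cong length (filter-dec-just (λ ab d → ¬? (d ≟ₚ proj₁ ab))
                            (swapped-adjacent ps s (proj₁ (unique-adjacent ps (proj₁ lo)))) (twoSets n)))
            (length-filter-≢-twoSets (proj₁ (adjacent-twoSets lo)))

  flip-into-V : ∀ ps {a b : Pair n} s {c} → IsEdge (adjacent ps a b s) → IsTwoSet c → Disjoint a c →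
    (adjacent (map (transpose b c) ps) a c (map (transpose b c) s) , b) ∈ V
  flip-into-V ps {a} {b} s {c} edge@(lo , _) c⁺ a-c =
    ∈-filter⁺ otherThanFirst?
      (∈-cartesianProduct⁺ (Equivalence.from (W⇔ _) (edge′ , samePhi-swap-disjoint ps′ s′ a≢c a-c)) (∈-twoSets⁺ b⁺))
      (Equivalence.from (first-adjacent ps′ s′ a≢c) (a≢b ∘ sym))
    where
    ps′ = map (transpose b c) ps
    s′ = map (transpose b c) s
    a≢b = proj₁ (unique-adjacent ps (proj₁ lo))
    a≢c = disjoint⇒≢ a-c
    b⁺ = proj₂ (adjacent-twoSets lo)
    edge′ = edge-transpose ps s edge c⁺ a≢b a≢c

  flip-into-U : ∀ ps {a b : Pair n} s {d} → IsWhiteEdge (adjacent ps a b s) → IsTwoSet d → d ≢ a →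
    (adjacent (map (transpose b d) ps) a d (map (transpose b d) s) , b) ∈ U
  flip-into-U ps {a} {b} s {d} (edge@(lo , _) , same) d⁺ d≢a =
    ∈-filter⁺ disjointFromFirst?
      (∈-cartesianProduct⁺ (Equivalence.from (E⇔ _) (edge-transpose ps s edge d⁺ a≢b (d≢a ∘ sym))) (∈-twoSets⁺ b⁺))
      (Equivalence.from (first-adjacent (map (transpose b d) ps) (map (transpose b d) s) (d≢a ∘ sym))
        (samePhi-swap⇒disjoint ps s a⁺ b⁺ (proj₁ lo) same))
    where
    a≢b = proj₁ (unique-adjacent ps (proj₁ lo))
    a⁺ = proj₁ (adjacent-twoSets lo)
    b⁺ = proj₂ (adjacent-twoSets lo)

  U→V : ∀ {x} → x ∈ U → flipSwap x ∈ V
  U→V {(o , o′) , c} x∈U with ∈-filter⁻ disjointFromFirst? x∈U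
  ... | x∈E×T , first-disjoint with ∈-cartesianProduct⁻ E (twoSets n) x∈E×T
  ... | e∈E , c∈T with Equivalence.to (E⇔ _) e∈E
  ... | edge@(lo , _ , ps , a , b , s , refl , refl) =
    let a≢b = proj₁ (unique-adjacent ps (proj₁ lo))
        a-c = Equivalence.to (first-adjacent ps s a≢b) first-disjoint
    in subst (_∈ V) (sym (flipSwap-adjacent ps s c a≢b (disjoint⇒≢ a-c)))
         (flip-into-V ps s edge (∈-twoSets⁻ c∈T) a-c)

  V→U : ∀ {x} → x ∈ V → flipSwap x ∈ U
  V→U {(o , o′) , d} x∈V with ∈-filter⁻ otherThanFirst? x∈V
  ... | x∈W×T , first-other with ∈-cartesianProduct⁻ W (twoSets n) x∈W×T
  ... | w∈W , d∈T with Equivalence.to (W⇔ _) w∈W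
  ... | white@((lo , _ , ps , a , b , s , refl , refl) , _) =
    let a≢b = proj₁ (unique-adjacent ps (proj₁ lo))
        d≢a = Equivalence.to (first-adjacent ps s a≢b) first-other
    in subst (_∈ U) (sym (flipSwap-adjacent ps s d a≢b (d≢a ∘ sym)))
         (flip-into-U ps s white (∈-twoSets⁻ d∈T) d≢a)

  whiteEdges-count : length W * (n C 2 ∸ 1) ≡ ((n ∸ 2) C 2) * length E
  whiteEdges-count = begin
    length W * (n C 2 ∸ 1)    ≡⟨ length-V ⟨
    length V                  ≡⟨ unique∧involution⇒length-≡ flipSwap flipSwap-involutive V⁺ U⁺ V→U U→V ⟩
    length U                  ≡⟨ length-U ⟩
    length E * ((n ∸ 2) C 2)  ≡⟨ *-comm (length E) ((n ∸ 2) C 2) ⟩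
    ((n ∸ 2) C 2) * length E  ∎
    where
    open ≡-Reasoning
    U⁺ = Unique.filter⁺ disjointFromFirst? (Unique.cartesianProduct⁺ E⁺ (twoSets⁺ n))
    V⁺ = Unique.filter⁺ otherThanFirst? (Unique.cartesianProduct⁺ W⁺ (twoSets⁺ n))

proposition5p15 : (n : ℕ) → 3 ≤ n →
    (E W : List (List (Pair n) × List (Pair n))) →
    Unique E → (∀ e → (e ∈ E) ⇔ IsEdge e) →
    Unique W → (∀ e → (e ∈ W) ⇔ IsWhiteEdge e) →
    (length E > 0)
    × (length W * ((n C 2) ∸ 1) ≡ ((n ∸ 2) C 2) * length E)
    × (length W * (n + 1) + 4 * length E ≡ (n + 1) * length E)
proposition5p15 (suc (suc (suc m))) (s≤s (s≤s (s≤s _))) E W E⁺ E⇔ W⁺ W⇔ =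
  -- twoSets (3 + m) computes to a list with two explicit leading 2-sets, whose swap is an edge.
  ∈-length (Equivalence.from (E⇔ _) (edge-at-head (twoSets-linOrder (3 + m)))) ,
  count ,
  white-proportion m (length W) (length E) count
  where
  count = DoubleCounting.whiteEdges-count E W E⁺ E⇔ W⁺ W⇔
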